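{- Let $a,b\in\mathbb{N}$ with $\gcd(a,b)=1$, let $\delta=\Gamma(a,b)$, and let $x^*,y^*$ be the nonnegative integers such that $\delta+ax^*+by^*=\frac{(a-1)(b-1)}{2}$. If $N$ is a nonnegative integer such that $\gcd(a,b+N)=1$ and $N\left(\frac{a-1}{2}-y^*\right)$ is an integer divisible by $a$, then $\Gamma(a,b+N)=\Gamma(a,b)$.
   Context: For relatively prime positive integers $a',b'$, exactly one of the two equations $a'x+b'y=\frac{(a'-1)(b'-1)}{2}$ and $1+a'x+b'y=\frac{(a'-1)(b'-1)}{2}$ has a solution $(x,y)$ in nonnegative integers (and it is unique). For $a,b\in\mathbb{N}$ let $g=\gcd(a,b)$, $a'=a/g$, $b'=b/g$; define $\Gamma(a,b)=0$ if $a'x+b'y=\frac{(a'-1)(b'-1)}{2}$ has a nonnegative integral solution, and $\Gamma(a,b)=1$ if $1+a'x+b'y=\frac{(a'-1)(b'-1)}{2}$ has a nonnegative integral solution. -}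

module Defs where

open import Data.Nat using (ℕ; zero; suc; _+_; _*_; _∸_; _<_)
open import Data.Nat.GCD using (gcd)
open import Data.Product using (Σ; ∃; _×_; _,_)
open import Data.Sum using (_⊎_)
open import Relation.Binary.PropositionalEquality using (_≡_)

-- The halving is cleared by multiplying by 2
-- (for coprime a',b' the product (a'-1)(b'-1) is even, and for a' = 0
-- or b' = 0 coprimality forces the other to be 1, so the product is 0
-- both with truncated and with integer subtraction).
Solvable : ℕ → ℕ → ℕ → Set
Solvable c a' b' = ∃ λ x → ∃ λ y → 2 * (c + a' * x + b' * y) ≡ (a' ∸ 1) * (b' ∸ 1)

-- Γ for coprime a', b':  Γ = 0 if the equation with c = 0 is solvable,
-- Γ = 1 if the equation with c = 1 is solvable (exactly one is, by the context).
GammaCoprimeIs : ℕ → ℕ → ℕ → Set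
GammaCoprimeIs a' b' δ = (δ ≡ 0 × Solvable 0 a' b') ⊎ (δ ≡ 1 × Solvable 1 a' b')

GammaIs : ℕ → ℕ → ℕ → Set
GammaIs a b δ = 0 < gcd a b × (∃ λ a' → ∃ λ b' →
  a ≡ a' * gcd a b × b ≡ b' * gcd a b × GammaCoprimeIs a' b' δ)

-- If (x, y) solves δ + a x + b y = (a-1)(b-1)/2 and a(2k) = N(a-1-2y), then
-- (x + k, y) solves δ + a x + (b+N) y = (a-1)(b+N-1)/2: the right-hand side
-- grows by N(a-1)/2 = a k + N y.  The only inequality needed, 2y ≤ a-1, is
-- read off the original equation, and it makes the integer a-1-2y a natural.
module Submission where

open import Defs
open import Data.Nat using (ℕ; _+_; _*_; _∸_)
open import Data.Nat.GCD using (gcd)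
open import Data.Integer using (+_; _-_)
open import Data.Integer.Divisibility using (_∣_)
open import Relation.Binary.PropositionalEquality using (_≡_)

open import Data.Nat using (zero; suc; _≤_; z≤n; s≤s)
open import Data.Nat.Properties
  using (m+n≡0⇒m≡0; m≤n+m; n≤1+n; *-comm; *-monoʳ-≤; *-cancelˡ-≤; *-identityʳ; *-zeroʳ; *-distribˡ-+; *-commutativeSemigroup; m∸n+n≡m; module ≤-Reasoning)
open import Data.Nat.Divisibility using (divides)
import Data.Nat.Divisibility as ℕ
import Data.Integer as ℤ
open import Data.Integer.Properties using (abs-*; pos-*; m-n≡m⊖n; ⊖-≥)
open import Data.Product using (_,_)
open import Algebra.Properties.CommutativeSemigroup *-commutativeSemigroup using (x∙yz≈y∙xz)
open import Data.Sum using (_⊎_; inj₁; inj₂)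
open import Relation.Binary.PropositionalEquality
  using (refl; sym; cong; cong₂; subst₂; module ≡-Reasoning)
open import Data.Nat.Tactic.RingSolver using (solve-∀)

GammaIs⇒δ≡0⊎δ≡1 : ∀ {a b δ} → GammaIs a b δ → δ ≡ 0 ⊎ δ ≡ 1
GammaIs⇒δ≡0⊎δ≡1 (_ , _ , _ , _ , _ , inj₁ (δ≡0 , _)) = inj₁ δ≡0
GammaIs⇒δ≡0⊎δ≡1 (_ , _ , _ , _ , _ , inj₂ (δ≡1 , _)) = inj₂ δ≡1

coprime∧solvable⇒GammaIs : ∀ a b δ → gcd a b ≡ 1 → δ ≡ 0 ⊎ δ ≡ 1 →
  Solvable δ a b → GammaIs a b δ
coprime∧solvable⇒GammaIs a b δ gcd≡1 δ∈01 sol rewrite gcd≡1 =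
  s≤s z≤n , a , b , sym (*-identityʳ a) , sym (*-identityʳ b) , gammaCoprime δ∈01
  where
  gammaCoprime : δ ≡ 0 ⊎ δ ≡ 1 → GammaCoprimeIs a b δ
  gammaCoprime (inj₁ refl) = inj₁ (refl , sol)
  gammaCoprime (inj₂ refl) = inj₂ (refl , sol)

-- For a ≤ 1 both sides of the defining equation vanish, whatever b is.

vanishing⇒δ≡0 : ∀ δ a b x y → 2 * (δ + a * x + b * y) ≡ 0 → δ ≡ 0
vanishing⇒δ≡0 δ a b x y eq = m+n≡0⇒m≡0 δ (m+n≡0⇒m≡0 _ (m+n≡0⇒m≡0 _ eq))

solvable₀-a≤1 : ∀ {a} → a ≤ 1 → ∀ b → Solvable 0 a b
solvable₀-a≤1 z≤n       b = 0 , 0 , cong (2 *_) (*-zeroʳ b)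
solvable₀-a≤1 (s≤s z≤n) b = 0 , 0 , cong (2 *_) (*-zeroʳ b)

-- Below a = 1 + c and b = 1 + d, so that (a-1)(b-1) = c d without truncation.

2y≤a-1 : ∀ c d δ x y → 2 * (δ + suc c * x + suc d * y) ≡ c * d → 2 * y ≤ c
2y≤a-1 c d δ x y eq = *-cancelˡ-≤ (suc d) (begin
  suc d * (2 * y)                          ≡⟨ x∙yz≈y∙xz (suc d) 2 y ⟩
  2 * (suc d * y)                          ≤⟨ m≤n+m _ (2 * (δ + suc c * x)) ⟩
  2 * (δ + suc c * x) + 2 * (suc d * y)    ≡⟨ *-distribˡ-+ 2 (δ + suc c * x) (suc d * y) ⟨
  2 * (δ + suc c * x + suc d * y)          ≡⟨ eq ⟩
  c * d                                    ≤⟨ *-monoʳ-≤ c (n≤1+n d) ⟩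
  c * suc d                                ≡⟨ *-comm c (suc d) ⟩
  suc d * c                                ∎)
  where open ≤-Reasoning

shifted-solution : ∀ c d δ x y N k r →
  2 * (δ + suc c * x + suc d * y) ≡ c * d → r + 2 * y ≡ c → N * r ≡ k * (2 * suc c) →
  2 * (δ + suc c * (x + k) + (suc d + N) * y) ≡ c * (d + N)
shifted-solution c d δ x y N k r eq r+2y≡c Nr≡2ak = begin
  2 * (δ + suc c * (x + k) + (suc d + N) * y)                       ≡⟨ expand δ c x k d N y ⟩
  2 * (δ + suc c * x + suc d * y) + k * (2 * suc c) + N * (2 * y)   ≡⟨ cong₂ (λ u v → u + v + N * (2 * y)) eq (sym Nr≡2ak) ⟩
  c * d + N * r + N * (2 * y)                                       ≡⟨ regroup c d N r y ⟩
  c * d + N * (r + 2 * y)                                           ≡⟨ cong (λ u → c * d + N * u) r+2y≡c ⟩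
  c * d + N * c                                                     ≡⟨ factor c d N ⟩
  c * (d + N)                                                       ∎
  where
  open ≡-Reasoning
  expand : ∀ δ c x k d N y → 2 * (δ + suc c * (x + k) + (suc d + N) * y)
                           ≡ 2 * (δ + suc c * x + suc d * y) + k * (2 * suc c) + N * (2 * y)
  expand = solve-∀
  regroup : ∀ c d N r y → c * d + N * r + N * (2 * y) ≡ c * d + N * (r + 2 * y)
  regroup = solve-∀
  factor : ∀ c d N → c * d + N * c ≡ c * (d + N)
  factor = solve-∀

a-1-2y≡+ : ∀ c y → 2 * y ≤ c → (+ suc c - + 1) - (+ 2) ℤ.* (+ y) ≡ + (c ∸ 2 * y)
a-1-2y≡+ c y 2y≤c = begin
  (+ suc c - + 1) - (+ 2) ℤ.* (+ y)   ≡⟨ cong (λ u → + c - u) (pos-* 2 y) ⟨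
  + c - + (2 * y)                     ≡⟨ m-n≡m⊖n c (2 * y) ⟩
  c ℤ.⊖ (2 * y)                       ≡⟨ ⊖-≥ 2y≤c ⟩
  + (c ∸ 2 * y)                       ∎
  where open ≡-Reasoning

∣ℤ⇒∣ℕ : ∀ c y N → 2 * y ≤ c →
  (+ 2) ℤ.* (+ suc c) ∣ (+ N) ℤ.* ((+ suc c - + 1) - (+ 2) ℤ.* (+ y)) →
  2 * suc c ℕ.∣ N * (c ∸ 2 * y)
∣ℤ⇒∣ℕ c y N 2y≤c = subst₂ ℕ._∣_ (abs-* (+ 2) (+ suc c)) (begin
  ℤ.∣ + N ℤ.* ((+ suc c - + 1) - (+ 2) ℤ.* (+ y)) ∣   ≡⟨ abs-* (+ N) _ ⟩
  N * ℤ.∣ (+ suc c - + 1) - (+ 2) ℤ.* (+ y) ∣         ≡⟨ cong (λ u → N * ℤ.∣ u ∣) (a-1-2y≡+ c y 2y≤c) ⟩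
  N * (c ∸ 2 * y)                                     ∎)
  where open ≡-Reasoning

solvable-shift : ∀ a b δ x y N → gcd a b ≡ 1 →
  2 * (δ + a * x + b * y) ≡ (a ∸ 1) * (b ∸ 1) →
  (+ 2) ℤ.* (+ a) ∣ (+ N) ℤ.* ((+ a - + 1) - (+ 2) ℤ.* (+ y)) →
  Solvable δ a (b + N)
solvable-shift zero b δ x y N _ eq _
  rewrite vanishing⇒δ≡0 δ 0 b x y eq = solvable₀-a≤1 z≤n (b + N)
solvable-shift (suc zero) b δ x y N _ eq _
  rewrite vanishing⇒δ≡0 δ 1 b x y eq = solvable₀-a≤1 (s≤s z≤n) (b + N)
-- gcd a 0 computes to a, so coprimality excludes b = 0 once a ≥ 2.
solvable-shift (suc (suc _)) zero _ _ _ _ ()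
solvable-shift (suc c) (suc d) δ x y N _ eq 2a∣Nr
  with 2y≤c ← 2y≤a-1 c d δ x y eq
  with divides k Nr≡k2a ← ∣ℤ⇒∣ℕ c y N 2y≤c 2a∣Nr
  = x + k , y , shifted-solution c d δ x y N k (c ∸ 2 * y) eq (m∸n+n≡m 2y≤c) Nr≡k2a

mainTheorem5 : (a b : ℕ) → gcd a b ≡ 1 →
    (δ : ℕ) → GammaIs a b δ →
    (xs ys : ℕ) → 2 * (δ + a * xs + b * ys) ≡ (a ∸ 1) * (b ∸ 1) →
    (N : ℕ) → gcd a (b + N) ≡ 1 →
    (+ 2) Data.Integer.* (+ a) ∣ (+ N) Data.Integer.* ((+ a - + 1) - (+ 2) Data.Integer.* (+ ys)) →
    GammaIs a (b + N) δ
mainTheorem5 a b gcd≡1 δ γ xs ys eq N gcd′≡1 2a∣N[a-1-2y] =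
  coprime∧solvable⇒GammaIs a (b + N) δ gcd′≡1 (GammaIs⇒δ≡0⊎δ≡1 γ)
    (solvable-shift a b δ xs ys N gcd≡1 eq 2a∣N[a-1-2y])
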